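{- Let $\Sigma$ be a totally ordered alphabet, $w \ge 1$ an integer, $E \subseteq \Sigma^w$ any set of strings of length $w$, and $E' = E \cup \{\mathtt{\#}, \mathtt{\$}^w\}$, where $\mathtt{\#}$ and $\mathtt{\$}$ are special symbols not in $\Sigma$ that are lexicographically smaller than every symbol of $\Sigma$. Let $T[0..n-1]$ be a string over $\Sigma$. Let $D$ be the maximal set of strings $d$ such that: $d$ is a substring of $\mathtt{\#}\,T\,\mathtt{\$}^w$; exactly one proper prefix of $d$ is in $E'$; exactly one proper suffix of $d$ is in $E'$; and no other substring of $d$ is in $E'$. Let $S$ be the set of all suffixes of elements of $D$ that have length greater than $w$. Then $S$ is prefix-free, i.e., no element of $S$ is a proper prefix of another element of $S$.
   Context: Strings over $\Sigma \cup \{\mathtt{\#},\mathtt{\$}\}$ are compared in the usual lexicographic order induced by the order of symbols. $\mathtt{\$}^w$ denotes $w$ copies of $\mathtt{\$}$. -}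

module Defs where

open import Data.Nat using (ℕ; zero; suc; _+_; _∸_; _≤_; _<_)
open import Data.List using (List; []; _∷_; _++_; [_]; map; take; drop; replicate; length)
open import Data.Product using (Σ; ∃; ∃₂; _×_; _,_)
open import Data.Sum using (_⊎_)
open import Relation.Binary.PropositionalEquality using (_≡_)

-- Extended alphabet Σ ∪ {#, $}.  (# and $ are smaller than every symbol
-- of Σ; the order plays no role in the prefix-freeness statement.)
data Sym (A : Set) : Set where
  hash   : Sym A
  dollar : Sym A
  chr    : A → Sym A

Str : Set → Set
Str A = List (Sym A)

slice : {X : Set} → ℕ → ℕ → List X → List X
slice i j xs = take (j ∸ i) (drop i xs)

InE' : {A : Set} → ℕ → (List A → Set) → Str A → Set
InE' w E s = (s ≡ [ hash ]) ⊎ ((s ≡ replicate w dollar) ⊎ (∃ λ u → E u × s ≡ map chr u))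

text : {A : Set} → ℕ → List A → Str A
text w T = hash ∷ (map chr T ++ replicate w dollar)

Substring : {A : Set} → Str A → Str A → Set
Substring d t = ∃₂ λ u v → t ≡ u ++ (d ++ v)

InD : {A : Set} → ℕ → (List A → Set) → List A → Str A → Set
InD w E T d =
  Substring d (text w T) ×
  (Σ ℕ λ p → Σ ℕ λ q →
     p < length d × 0 < q × q ≤ length d ×
     InE' w E (take p d) × InE' w E (drop q d) ×
     (∀ i j → i ≤ j → j ≤ length d → InE' w E (slice i j d) →
        (i ≡ 0 × j ≡ p) ⊎ (i ≡ q × j ≡ length d)))

InS : {A : Set} → ℕ → (List A → Set) → List A → Str A → Set
InS w E T s = ∃ λ d → InD w E T d × (Σ ℕ λ k → s ≡ drop k d) × w < length s

ProperPrefix : {X : Set} → List X → List X → Set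
ProperPrefix xs ys = ∃ λ u → 0 < length u × ys ≡ xs ++ u

-- The E'-suffix e of d₁ has length at most w, so it is also a suffix of any
-- suffix s₁ of d₁ longer than w, and it is preceded in s₁ by at least one
-- symbol.  If s₁ were a proper prefix of a suffix s₂ of d₂, then e would occur
-- in d₂ strictly inside: not at position 0 and not ending at the end of d₂.
-- But the only E'-occurrences in an element of D are its prefix and its suffix.
module Submission where

open import Defs
open import Level using (0ℓ)
open import Data.Nat using (ℕ; _≤_; _<_; zero; suc; _+_; s≤s)
open import Data.Nat.Properties
open import Data.List using (List; length; []; _∷_; _++_; take; drop)
open import Data.List.Properties using (length-++; length-drop; length-map; length-replicate; take++drop≡id; ++-assoc)
open import Data.Product using (∃; _×_; _,_; proj₁; proj₂)
open import Data.Sum as Sum using (_⊎_; inj₁; inj₂)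
open import Function using (_∘_)
open import Relation.Binary.Bundles using (StrictTotalOrder)
open import Relation.Binary.PropositionalEquality
open import Relation.Nullary using (¬_; contradiction)

module _ {X : Set} where

  take-length-++ : ∀ (xs ys : List X) → take (length xs) (xs ++ ys) ≡ xs
  take-length-++ []       ys = refl
  take-length-++ (x ∷ xs) ys = cong (x ∷_) (take-length-++ xs ys)

  slice-++-middle : ∀ (xs ys zs : List X) →
                    slice (length xs) (length xs + length ys) (xs ++ ys ++ zs) ≡ ys
  slice-++-middle []       ys zs = take-length-++ ys zs
  slice-++-middle (x ∷ xs) ys zs = slice-++-middle xs ys zs

  length-drop-≤ : ∀ n (xs : List X) → length (drop n xs) ≤ length xs
  length-drop-≤ n xs = ≤-trans (≤-reflexive (length-drop n xs)) (m∸n≤m (length xs) n)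

  drop-suffix-of-drop : ∀ (xs : List X) a b → length (drop a xs) ≤ length (drop b xs) →
                        ∃ λ ys → drop b xs ≡ ys ++ drop a xs
  drop-suffix-of-drop []       zero    zero    _ = [] , refl
  drop-suffix-of-drop []       zero    (suc b) _ = [] , refl
  drop-suffix-of-drop []       (suc a) zero    _ = [] , refl
  drop-suffix-of-drop []       (suc a) (suc b) _ = [] , refl
  drop-suffix-of-drop (x ∷ xs) zero    zero    _ = [] , refl
  drop-suffix-of-drop (x ∷ xs) zero    (suc b) |x∷xs|≤ =
    contradiction |x∷xs|≤ (<⇒≱ (s≤s (length-drop-≤ b xs)))
  drop-suffix-of-drop (x ∷ xs) (suc a) zero    _ =
    let ys , xs≡ys++ = drop-suffix-of-drop xs a zero (length-drop-≤ a xs)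
    in x ∷ ys , cong (x ∷_) xs≡ys++
  drop-suffix-of-drop (x ∷ xs) (suc a) (suc b) le = drop-suffix-of-drop xs a b le

  length-++-++ : ∀ (xs ys zs : List X) →
                 length (xs ++ ys ++ zs) ≡ (length xs + length ys) + length zs
  length-++-++ xs ys zs = begin
    length (xs ++ ys ++ zs)             ≡⟨ length-++ xs ⟩
    length xs + length (ys ++ zs)       ≡⟨ cong (length xs +_) (length-++ ys) ⟩
    length xs + (length ys + length zs) ≡⟨ +-assoc (length xs) _ _ ⟨
    (length xs + length ys) + length zs ∎
    where open ≡-Reasoning

  occurrence-at-border : {P : List X → Set} {p q : ℕ} (d : List X) →
    (∀ i j → i ≤ j → j ≤ length d → P (slice i j d) →
       (i ≡ 0 × j ≡ p) ⊎ (i ≡ q × j ≡ length d)) →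
    ∀ xs ys zs → d ≡ xs ++ ys ++ zs → P ys → length xs ≡ 0 ⊎ length zs ≡ 0
  occurrence-at-border {P} _ only xs ys zs refl ys∈P =
    Sum.map proj₁ (|zs|≡0 ∘ proj₂)
      (only i j (m≤m+n i (length ys)) j≤|d| (subst P (sym (slice-++-middle xs ys zs)) ys∈P))
    where
    i j : ℕ
    i = length xs
    j = i + length ys

    |d|≡j+|zs| : length (xs ++ ys ++ zs) ≡ j + length zs
    |d|≡j+|zs| = length-++-++ xs ys zs

    j≤|d| : j ≤ length (xs ++ ys ++ zs)
    j≤|d| = ≤-trans (m≤m+n j (length zs)) (≤-reflexive (sym |d|≡j+|zs|))

    |zs|≡0 : j ≡ length (xs ++ ys ++ zs) → length zs ≡ 0
    |zs|≡0 j≡|d| = +-cancelˡ-≡ j _ _ (trans (sym |d|≡j+|zs|) (trans (sym j≡|d|) (sym (+-identityʳ j))))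

InE'-length-≤ : {A : Set} {w : ℕ} {E : List A → Set} → 1 ≤ w →
                (∀ u → E u → length u ≡ w) → ∀ s → InE' w E s → length s ≤ w
InE'-length-≤ 1≤w E-len _ (inj₁ refl)                       = 1≤w
InE'-length-≤ 1≤w E-len _ (inj₂ (inj₁ refl))                = ≤-reflexive (length-replicate _)
InE'-length-≤ 1≤w E-len _ (inj₂ (inj₂ (u , u∈E , refl))) =
  ≤-reflexive (trans (length-map chr u) (E-len u u∈E))

InD-long-suffix : {A : Set} {w : ℕ} {E : List A → Set} {T : List A} {d : Str A} →
  1 ≤ w → (∀ u → E u → length u ≡ w) → InD w E T d →
  ∀ k → w < length (drop k d) →
  ∃ λ pre → ∃ λ e → 0 < length pre × InE' w E e × drop k d ≡ pre ++ e
InD-long-suffix {d = d} 1≤w E-len (_ , _ , q , _ , _ , _ , _ , e∈E' , _) k w<|s| =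
  let pre , s≡pre++e = drop-suffix-of-drop d q k (<⇒≤ |e|<|s|)
  in  pre , drop q d , 0<length pre s≡pre++e , e∈E' , s≡pre++e
  where
  |e|<|s| : length (drop q d) < length (drop k d)
  |e|<|s| = <-≤-trans (s≤s (InE'-length-≤ 1≤w E-len _ e∈E')) w<|s|

  0<length : ∀ pre → drop k d ≡ pre ++ drop q d → 0 < length pre
  0<length pre s≡pre++e = +-cancelʳ-< (length (drop q d)) 0 (length pre)
    (<-≤-trans |e|<|s| (≤-reflexive (trans (cong length s≡pre++e) (length-++ pre))))

lemma1 : (O : StrictTotalOrder 0ℓ 0ℓ 0ℓ) → (w : ℕ) → 1 ≤ w →
         (E : List (StrictTotalOrder.Carrier O) → Set) →
         (∀ u → E u → length u ≡ w) →
         (T : List (StrictTotalOrder.Carrier O)) →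
         ∀ s₁ s₂ → InS w E T s₁ → InS w E T s₂ → ¬ ProperPrefix s₁ s₂
lemma1 O w 1≤w E E-len T _ _
  (d₁ , d₁∈D , (k₁ , refl) , w<|s₁|)
  (d₂ , (_ , _ , _ , _ , _ , _ , _ , _ , only) , (k₂ , refl) , _)
  (u , 0<|u| , s₂≡s₁++u)
  with InD-long-suffix 1≤w E-len d₁∈D k₁ w<|s₁|
... | pre , e , 0<|pre| , e∈E' , s₁≡pre++e
  with occurrence-at-border d₂ only (take k₂ d₂ ++ pre) e u d₂≡ e∈E'
  where
  d₂≡ : d₂ ≡ (take k₂ d₂ ++ pre) ++ e ++ u
  d₂≡ = begin
    d₂                               ≡⟨ take++drop≡id k₂ d₂ ⟨
    take k₂ d₂ ++ drop k₂ d₂         ≡⟨ cong (take k₂ d₂ ++_) (trans s₂≡s₁++u (cong (_++ u) s₁≡pre++e)) ⟩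
    take k₂ d₂ ++ (pre ++ e) ++ u    ≡⟨ cong (take k₂ d₂ ++_) (++-assoc pre e u) ⟩
    take k₂ d₂ ++ pre ++ e ++ u      ≡⟨ ++-assoc (take k₂ d₂) pre (e ++ u) ⟨
    (take k₂ d₂ ++ pre) ++ e ++ u    ∎
    where open ≡-Reasoning
... | inj₁ |prefix|≡0 =
  <⇒≢ 0<|pre| (sym (m+n≡0⇒n≡0 _ (trans (sym (length-++ (take k₂ d₂))) |prefix|≡0)))
... | inj₂ |u|≡0 = <⇒≢ 0<|u| (sym |u|≡0)
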